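{- Let $G$ be a graph on $n$ vertices, let $J$ be a $(k,k)$-bigraph, and let $X,Y\subseteq V(G)$ be such that $G[X]$ is $J$-free and $Y$ is $(k,s)$-unrestricted. Then $\min\{|X\setminus Y|,|X\cap Y|\}\le ks$.
   Context: A $(k,k)$-bigraph is a triple $(H,A,B)$ with $H$ bipartite with bipartition $(A,B)$, $|A|=|B|=k$. An embedding of such a bigraph into a graph $G$ is an injection $\eta:A\cup B\to V(G)$ such that for all $u\in A$, $v\in B$: $uv\in E(H)$ iff $\eta(u)\eta(v)\in E(G)$; $G$ is $J$-free if no such embedding exists. An ordered bigraph has both sides linearly ordered; ordered bigraphs are isomorphic if order-preserving bijections of the sides preserve adjacency. For ordered disjoint $A,B\subseteq V(G)$, $G[A,B]$ is the ordered bigraph formed by the edges of $G$ between $A$ and $B$. A $k$-base on a set $X$ is a collection of pairwise disjoint ordered $k$-element subsets of $X$. A pair $(\mathcal{A},\mathcal{B})$ of $k$-bases is $J'$-free, for an ordered $(k,k)$-bigraph $J'$, if $G[A,B]$ is not isomorphic to $J'$ for all $A\in\mathcal{A}$, $B\in\mathcal{B}$, and restricted if it is $J'$-free for some ordered $(k,k)$-bigraph $J'$. A set $Y\subseteq V(G)$ is $(k,s)$-restricted if there are a $k$-base $\mathcal{A}$ on $Y$ and a $k$-base $\mathcal{B}$ on $V(G)\setminus Y$ with $|\mathcal{A}|,|\mathcal{B}|\ge s$ and $(\mathcal{A},\mathcal{B})$ restricted; otherwise $Y$ is $(k,s)$-unrestricted. -}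

module Defs where

open import Data.Nat using (ℕ; _≤_)
open import Data.Bool using (Bool; true; false)
open import Data.Fin using (Fin) renaming (_<_ to _<ᶠ_)
open import Data.Fin.Subset using (Subset; _∈_; _∉_; ∁)
open import Data.Sum using (_⊎_; inj₁; inj₂)
open import Data.Product using (Σ; ∃; ∃-syntax; _×_; _,_)
open import Relation.Nullary using (¬_)
open import Relation.Binary.PropositionalEquality using (_≡_; _≢_)
open import Function.Definitions using (Injective; Bijective)

record Graph (n : ℕ) : Set where
  field
    adj   : Fin n → Fin n → Bool
    sym   : ∀ u v → adj u v ≡ adj v u
    irrefl : ∀ v → adj v v ≡ false
open Graph public

-- A (k,k)-bigraph (H, A, B) with A = B = Fin k (as disjoint copies):
-- H a b = true iff a ∈ A and b ∈ B are adjacent.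
Bigraph : ℕ → Set
Bigraph k = Fin k → Fin k → Bool

-- An ordered (k,k)-bigraph: both sides are Fin k with their natural order.
OrdBigraph : ℕ → Set
OrdBigraph k = Fin k → Fin k → Bool

record EmbeddingInto {n k : ℕ} (G : Graph n) (J : Bigraph k) (X : Subset n) : Set where
  field
    η      : Fin k ⊎ Fin k → Fin n
    inj    : Injective _≡_ _≡_ η
    inX    : ∀ w → η w ∈ X
    edges  : ∀ u v → J u v ≡ adj G (η (inj₁ u)) (η (inj₂ v))

InducedFree : ∀ {n k} → Graph n → Bigraph k → Subset n → Set
InducedFree G J X = ¬ EmbeddingInto G J X

OrderPreserving : ∀ {k} → (Fin k → Fin k) → Set
OrderPreserving {k} φ = ∀ {i j : Fin k} → i <ᶠ j → φ i <ᶠ φ j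

OrdIso : ∀ {k} → OrdBigraph k → OrdBigraph k → Set
OrdIso {k} H H' =
  Σ (Fin k → Fin k) λ φ → Σ (Fin k → Fin k) λ ψ →
    Bijective _≡_ _≡_ φ × OrderPreserving φ ×
    Bijective _≡_ _≡_ ψ × OrderPreserving ψ ×
    (∀ i j → H i j ≡ H' (φ i) (ψ j))

-- An ordered k-element subset of V(G): an injective enumeration Fin k → Fin n
-- (the set is the image, the order is given by the enumeration).
OrdSubset : ℕ → ℕ → Set
OrdSubset n k = Σ (Fin k → Fin n) λ a → Injective _≡_ _≡_ a

record KBase (n k : ℕ) (X : Subset n) (m : ℕ) : Set where
  field
    member   : Fin m → OrdSubset n k
    inside   : ∀ p i → Σ.proj₁ (member p) i ∈ X
    disjoint : ∀ p q → p ≢ q → ∀ i j →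
               Σ.proj₁ (member p) i ≢ Σ.proj₁ (member q) j
open KBase public

between : ∀ {n k} → Graph n → OrdSubset n k → OrdSubset n k → OrdBigraph k
between G (a , _) (b , _) i j = adj G (a i) (b j)

PairFree : ∀ {n k X Y m m'} → Graph n → OrdBigraph k →
           KBase n k X m → KBase n k Y m' → Set
PairFree G J' 𝒜 ℬ = ∀ p q → ¬ OrdIso (between G (member 𝒜 p) (member ℬ q)) J'

Restricted : ∀ {n k X Y m m'} → Graph n → KBase n k X m → KBase n k Y m' → Set
Restricted {k = k} G 𝒜 ℬ = ∃[ J' ] PairFree {k = k} G J' 𝒜 ℬ

KSRestricted : ∀ {n} → Graph n → ℕ → ℕ → Subset n → Set
KSRestricted {n} G k s Y =
  ∃[ m ] ∃[ m' ] Σ (KBase n k Y m) λ 𝒜 → Σ (KBase n k (∁ Y) m') λ ℬ →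
    s ≤ m × s ≤ m' × Restricted G 𝒜 ℬ

KSUnrestricted : ∀ {n} → Graph n → ℕ → ℕ → Subset n → Set
KSUnrestricted G k s Y = ¬ KSRestricted G k s Y

module Submission where

-- Suppose both |X ∖ Y| and |X ∩ Y| exceed k·s.
-- Then s·k distinct vertices of X ∩ Y can be cut into s consecutive blocks
-- of k, giving a k-base 𝒜 on Y with s members; likewise X ∖ Y yields a
-- k-base ℬ on V(G) ∖ Y with s members.  Every pair A ∈ 𝒜, B ∈ ℬ consists of
-- disjoint k-sets inside X, so an ordered isomorphism G[A,B] ≅ J (J read as
-- an ordered bigraph) would be an embedding of J into G[X].  As G[X] is
-- J-free, (𝒜, ℬ) is J-free, hence restricted, so Y is (k,s)-restricted,
-- contradicting the hypothesis.

open import Defs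
open import Data.Nat using (ℕ; zero; suc; _≤_; _*_; _⊓_; s≤s)
open import Data.Nat.Properties
  using (m⊓n≤m; m⊓n≤n; ≤-trans; ≤-refl; _≤?_; ≰⇒>; <⇒≤; *-comm)
open import Data.Fin using (Fin; zero; suc; combine)
open import Data.Fin.Properties using (suc-injective; combine-injectiveˡ; combine-injectiveʳ)
open import Data.Fin.Subset using (Subset; _∩_; _─_; ∣_∣; _∈_; ∁)
  renaming (inside to included; outside to excluded)
open import Data.Fin.Subset.Properties using (x∈p∩q⁻; x∈p⇒x∉∁p)
open import Data.Vec using (_∷_; here; there)
open import Data.Sum using (_⊎_; inj₁; inj₂)
open import Data.Product using (Σ; _×_; _,_; proj₁; proj₂)
open import Data.Empty using (⊥-elim)
open import Relation.Nullary using (¬_; yes; no)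
open import Relation.Binary.PropositionalEquality
  using (_≡_; _≢_; refl; trans; cong; cong₂; subst; module ≡-Reasoning)
  renaming (sym to ≡-sym)
open import Function.Definitions using (Injective; Surjective)

record Enumeration {n : ℕ} (S : Subset n) (m : ℕ) : Set where
  field
    point     : Fin m → Fin n
    injective : Injective _≡_ _≡_ point
    point∈    : ∀ i → point i ∈ S
open Enumeration

widen : ∀ {n m} {S T : Subset n} → (∀ {x} → x ∈ S → x ∈ T) →
        Enumeration S m → Enumeration T m
widen S⊆T e = record
  { point = point e ; injective = injective e ; point∈ = λ i → S⊆T (point∈ e i) }

x∈p─q⁻ : ∀ {n} (p q : Subset n) {x : Fin n} → x ∈ p ─ q → x ∈ p × x ∈ ∁ q
x∈p─q⁻ (included ∷ p) (excluded ∷ q) here = here , here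
x∈p─q⁻ (included ∷ p) (included ∷ q) {zero} ()
x∈p─q⁻ (excluded ∷ p) (included ∷ q) {zero} ()
x∈p─q⁻ (excluded ∷ p) (excluded ∷ q) {zero} ()
x∈p─q⁻ (_ ∷ p) (_ ∷ q) (there x∈p─q) with x∈p─q⁻ p q x∈p─q
... | x∈p , x∈∁q = there x∈p , there x∈∁q

module _ {n : ℕ} {S : Subset n} where

  none : Enumeration S zero
  none = record { point = λ () ; injective = λ { {()} } ; point∈ = λ () }

  cons : ∀ {m} → Enumeration S m → Enumeration (included ∷ S) (suc m)
  cons {m} e = record { point = p ; injective = p-inj ; point∈ = p∈ }
    where
    p : Fin (suc m) → Fin (suc n)
    p zero    = zero
    p (suc i) = suc (point e i)
    p-inj : Injective _≡_ _≡_ p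
    p-inj {zero}  {zero}  _  = refl
    p-inj {suc i} {suc j} eq = cong suc (injective e (suc-injective eq))
    p-inj {zero}  {suc _} ()
    p-inj {suc _} {zero}  ()
    p∈ : ∀ i → p i ∈ (included ∷ S)
    p∈ zero    = here
    p∈ (suc i) = there (point∈ e i)

  skip : ∀ {m x} → Enumeration S m → Enumeration (x ∷ S) m
  skip e = record
    { point     = λ i → suc (point e i)
    ; injective = λ eq → injective e (suc-injective eq)
    ; point∈    = λ i → there (point∈ e i)
    }

enumerate : ∀ {n} m (S : Subset n) → m ≤ ∣ S ∣ → Enumeration S m
enumerate zero    _             _         = none
enumerate (suc m) (included ∷ S)  (s≤s m≤S) = cons (enumerate m S m≤S)
enumerate (suc m) (excluded ∷ S) m≤S       = skip (enumerate (suc m) S m≤S)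

-- Cutting an enumeration of s·k vertices of T into s consecutive blocks of
-- k gives a k-base on T with s members; block p, position i is point p·k+i.
blocks : ∀ {n} k s {T : Subset n} → Enumeration T (s * k) → KBase n k T s
blocks k s e = record
  { member   = λ p → (λ i → point e (combine p i)) ,
                     λ {i} {j} eq → combine-injectiveʳ p i p j (injective e eq)
  ; inside   = λ p i → point∈ e (combine p i)
  ; disjoint = λ p q p≢q i j eq → p≢q (combine-injectiveˡ p i q j (injective e eq))
  }

section : ∀ {k} {φ : Fin k → Fin k} → Surjective _≡_ _≡_ φ →
          Σ (Fin k → Fin k) λ φ⁻¹ → ∀ u → φ (φ⁻¹ u) ≡ u
section surj = (λ u → proj₁ (surj u)) , λ u → proj₂ (surj u) refl

isoEmbeds : ∀ {n k} (G : Graph n) (J : Bigraph k) (X : Subset n) (A B : OrdSubset n k) →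
            (∀ i → proj₁ A i ∈ X) → (∀ j → proj₁ B j ∈ X) →
            (∀ i j → proj₁ A i ≢ proj₁ B j) →
            OrdIso (between G A B) J → EmbeddingInto G J X
isoEmbeds {n} {k} G J X (a , a-inj) (b , b-inj) a∈X b∈X a≢b
          (φ , ψ , (_ , φ-surj) , _ , (_ , ψ-surj) , _ , G≅J) = record
  { η = η ; inj = η-inj ; inX = η∈X ; edges = edges }
  where
  φ⁻¹ ψ⁻¹ : Fin k → Fin k
  φ⁻¹ = proj₁ (section φ-surj)
  ψ⁻¹ = proj₁ (section ψ-surj)

  φφ⁻¹ : ∀ u → φ (φ⁻¹ u) ≡ u
  φφ⁻¹ = proj₂ (section φ-surj)
  ψψ⁻¹ : ∀ v → ψ (ψ⁻¹ v) ≡ v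
  ψψ⁻¹ = proj₂ (section ψ-surj)

  η : Fin k ⊎ Fin k → Fin n
  η (inj₁ u) = a (φ⁻¹ u)
  η (inj₂ v) = b (ψ⁻¹ v)

  η-inj : Injective _≡_ _≡_ η
  η-inj {inj₁ u} {inj₁ u'} eq =
    cong inj₁ (trans (≡-sym (φφ⁻¹ u)) (trans (cong φ (a-inj eq)) (φφ⁻¹ u')))
  η-inj {inj₂ v} {inj₂ v'} eq =
    cong inj₂ (trans (≡-sym (ψψ⁻¹ v)) (trans (cong ψ (b-inj eq)) (ψψ⁻¹ v')))
  η-inj {inj₁ u} {inj₂ v} eq = ⊥-elim (a≢b _ _ eq)
  η-inj {inj₂ v} {inj₁ u} eq = ⊥-elim (a≢b _ _ (≡-sym eq))

  η∈X : ∀ w → η w ∈ X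
  η∈X (inj₁ u) = a∈X (φ⁻¹ u)
  η∈X (inj₂ v) = b∈X (ψ⁻¹ v)

  edges : ∀ u v → J u v ≡ adj G (η (inj₁ u)) (η (inj₂ v))
  edges u v = begin
    J u v                           ≡⟨ cong₂ J (φφ⁻¹ u) (ψψ⁻¹ v) ⟨
    J (φ (φ⁻¹ u)) (ψ (ψ⁻¹ v))       ≡⟨ G≅J (φ⁻¹ u) (ψ⁻¹ v) ⟨
    adj G (a (φ⁻¹ u)) (b (ψ⁻¹ v))   ∎
    where open ≡-Reasoning

splitPairFree : ∀ {n k m m'} (G : Graph n) (J : Bigraph k) (X Y : Subset n) →
                InducedFree G J X →
                (𝒜 : KBase n k Y m) (ℬ : KBase n k (∁ Y) m') →
                (∀ p i → proj₁ (member 𝒜 p) i ∈ X) →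
                (∀ q j → proj₁ (member ℬ q) j ∈ X) →
                PairFree G J 𝒜 ℬ
splitPairFree G J X Y J-free 𝒜 ℬ 𝒜⊆X ℬ⊆X p q A≅J =
  J-free (isoEmbeds G J X (member 𝒜 p) (member ℬ q) (𝒜⊆X p) (ℬ⊆X q) A≢B A≅J)
  where
  A≢B : ∀ i j → proj₁ (member 𝒜 p) i ≢ proj₁ (member ℬ q) j
  A≢B i j eq = x∈p⇒x∉∁p (subst (_∈ Y) eq (inside 𝒜 p i)) (inside ℬ q j)

largeSplitRestricted : ∀ {n} k s (G : Graph n) (J : Bigraph k) (X Y : Subset n) →
                       InducedFree G J X →
                       s * k ≤ ∣ X ∩ Y ∣ → s * k ≤ ∣ X ─ Y ∣ →
                       KSRestricted G k s Y
largeSplitRestricted {n} k s G J X Y J-free in≥ out≥ =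
  s , s , 𝒜 , ℬ , ≤-refl , ≤-refl , J ,
  splitPairFree G J X Y J-free 𝒜 ℬ
    (λ p i → proj₁ (x∈p∩q⁻ X Y (point∈ eIn (combine p i))))
    (λ q j → proj₁ (x∈p─q⁻ X Y (point∈ eOut (combine q j))))
  where
  eIn : Enumeration (X ∩ Y) (s * k)
  eIn = enumerate (s * k) (X ∩ Y) in≥
  eOut : Enumeration (X ─ Y) (s * k)
  eOut = enumerate (s * k) (X ─ Y) out≥
  𝒜 : KBase n k Y s
  𝒜 = blocks k s (widen (λ x∈ → proj₂ (x∈p∩q⁻ X Y x∈)) eIn)
  ℬ : KBase n k (∁ Y) s
  ℬ = blocks k s (widen (λ x∈ → proj₂ (x∈p─q⁻ X Y x∈)) eOut)

lemma3p10 : (n k s : ℕ) (G : Graph n) (J : Bigraph k) (X Y : Subset n) →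
            InducedFree G J X → KSUnrestricted G k s Y →
            ∣ X ─ Y ∣ ⊓ ∣ X ∩ Y ∣ ≤ k * s
lemma3p10 n k s G J X Y J-free unrestricted
  with ∣ X ─ Y ∣ ≤? k * s | ∣ X ∩ Y ∣ ≤? k * s
... | yes out≤ | _       = ≤-trans (m⊓n≤m _ _) out≤
... | no _     | yes in≤ = ≤-trans (m⊓n≤n _ _) in≤
... | no out>  | no in>  =
  ⊥-elim (unrestricted (largeSplitRestricted k s G J X Y J-free (large in>) (large out>)))
  where
  large : ∀ {m} → ¬ m ≤ k * s → s * k ≤ m
  large {m} m≰ = subst (_≤ m) (*-comm k s) (<⇒≤ (≰⇒> m≰))
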